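{- Let $2\le k<r$ be integers and let $F$ be a graph. Then for every $n\ge r$, $$\mathrm{ex}_r(n,\mathcal{S}^rF)\le \binom{n}{r-k}\,\mathrm{ex}_k(n-r+k,\mathcal{S}^kF)\Big/\binom{r}{k}.$$ In particular, $\mathrm{ex}_r(n,\mathcal{S}^rF)\le \binom{n}{r-2}\,\mathrm{ex}(n-r+2,F)\big/\binom{r}{2}$, and the right-hand side equals $(1+o(1))\,2\binom{n}{r}\mathrm{ex}(n,F)/n^2$.
   Context: An $r$-uniform hypergraph ($r$-graph) is a hypergraph all of whose hyperedges have exactly $r$ vertices. For a graph $F$ and an integer $r\ge 2$, the $r$-uniform suspension $\mathcal{S}^rF$ is the $r$-graph obtained from $F$ by adding $r-2$ new vertices and adding all of them to every edge of $F$ (so $\mathcal{S}^2F=F$). For an $r$-graph $\mathcal{F}$, $\mathrm{ex}_r(n,\mathcal{F})$ is the maximum number of hyperedges in an $n$-vertex $r$-graph not containing $\mathcal{F}$ as a subhypergraph; $\mathrm{ex}(n,F)=\mathrm{ex}_2(n,F)$ is the ordinary graph Turán number. -}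

module Defs where

open import Data.Nat using (ℕ; _≤_; _∸_; _+_)
open import Data.Bool using (Bool; true; _∧_)
open import Data.Fin using (Fin; _≟_)
open import Data.Fin.Subset using (Subset; ∣_∣)
open import Data.Vec using (_++_; replicate; tabulate; lookup)
open import Data.List using (List; length; map; allFin)
open import Data.Bool.ListAction using (any)
open import Data.List.Relation.Unary.All using (All)
open import Data.List.Relation.Unary.Unique.Propositional using (Unique)
open import Data.List.Membership.Propositional using (_∈_)
open import Data.Product using (Σ; _×_)
open import Function.Definitions using (Injective)
open import Relation.Binary.PropositionalEquality using (_≡_)
open import Relation.Nullary using (¬_)
open import Relation.Nullary.Decidable using (⌊_⌋)

record Hypergraph (r n : ℕ) : Set where
  field
    edges   : List (Subset n)
    unique  : Unique edges
    uniform : All (λ e → ∣ e ∣ ≡ r) edges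
open Hypergraph public

e[_] : ∀ {r n} → Hypergraph r n → ℕ
e[ H ] = length (edges H)

image : ∀ {m n} → (Fin m → Fin n) → Subset m → Subset n
image {m} φ e = tabulate (λ j → any (λ i → lookup e i ∧ ⌊ φ i ≟ j ⌋) (allFin m))

Contains : ∀ {m n} → List (Subset m) → List (Subset n) → Set
Contains {m} {n} G H =
  Σ (Fin m → Fin n) λ φ → Injective _≡_ _≡_ φ × All (λ e → image φ e ∈ H) G

-- r-uniform suspension S^r F of a graph F on Fin v: vertex set Fin (v + (r - 2)),
-- the last r - 2 vertices being the new ones, added to every edge of F.
-- (Given by its edge list; for r ≥ 2 every edge has size r.)
Susp : ∀ {v} (r : ℕ) → Hypergraph 2 v → List (Subset (v + (r ∸ 2)))
Susp r F = map (λ e → e ++ replicate (r ∸ 2) true) (edges F)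

-- IsEx r n 𝓕 x : x = ex_r(n, 𝓕), i.e. x is the maximum number of edges of an
-- 𝓕-free r-graph on n vertices (attained, and an upper bound for all of them).
IsEx : ∀ {m} (r n : ℕ) → List (Subset m) → ℕ → Set
IsEx r n 𝓕 x =
  Σ (Hypergraph r n) (λ H → ¬ Contains 𝓕 (edges H) × e[ H ] ≡ x)
  × (∀ (H : Hypergraph r n) → ¬ Contains 𝓕 (edges H) → e[ H ] ≤ x)

-- Double counting over links.  If H is an r-graph on n vertices containing no S^r F,
-- then the link of any vertex x is an (r-1)-graph on n-1 vertices containing no
-- S^(r-1) F: an embedding of S^(r-1) F into the link extends to an embedding of S^r F
-- into H by sending one extra apex to x.  The links have r·e(H) edges in total, so
-- r·e(H) ≤ n·ex_(r-1)(n-1, S^(r-1) F).  Iterating r-k times, the absorption identities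
-- (j+1)·C(n+1,j+1) = (n+1)·C(n,j) and (j+1)·C(j+k+1,k) = (j+k+1)·C(j+k,k) turn the
-- accumulated factors into e(H)·C(r,k) ≤ C(n,r-k)·ex_k(n-r+k, S^k F).
module Submission where

open import Defs
open import Data.Bool using (Bool; true; false; _∧_; if_then_else_)
open import Data.Bool.ListAction using (any)
open import Data.Bool.Properties using (T-≡; T-∧; ⇔→≡)
open import Data.Empty using (⊥-elim)
open import Data.Fin using (Fin; zero; suc; _≟_; punchIn; punchOut; splitAt; join; _↑ˡ_; _↑ʳ_)
open import Data.Fin.Properties
  using (punchIn-injective; punchInᵢ≢i; punchIn-punchOut; splitAt-↑ˡ; splitAt-↑ʳ; splitAt-join; join-splitAt)
open import Data.Fin.Subset using (Subset; ∣_∣)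
open import Data.List using (List; []; _∷_; length; map; allFin)
open import Data.List.Membership.Propositional using (_∈_; lose)
open import Data.List.Membership.Propositional.Properties using (∈-allFin; ∈-map⁺)
import Data.List.Relation.Unary.All as All
open import Data.List.Relation.Unary.All using (All; []; _∷_)
import Data.List.Relation.Unary.All.Properties as All
open import Data.List.Relation.Unary.Any using (satisfied)
open import Data.List.Relation.Unary.Any.Properties using (any⁺; any⁻)
open import Data.List.Relation.Unary.Unique.Propositional using (Unique)
open import Data.List.Relation.Unary.AllPairs using ([]; _∷_)
open import Data.Nat using (ℕ; zero; suc; _+_; _*_; _∸_; _≤_; _<_; s≤s; z≤n)
open import Data.Nat.Combinatorics using (_C_; nCn≡1; nC1≡n; nCk≡nC[n∸k]; nCk+nC[k+1]≡[n+1]C[k+1])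
open import Data.Nat.Tactic.RingSolver using (solve-∀)
open import Data.Nat.Properties
  using (+-mono-≤; suc-injective; +-comm; +-assoc; +-identityʳ; *-zeroʳ; *-identityʳ; *-identityˡ; *-assoc;
         *-cancelˡ-≤; ≤-trans; <⇒≤; m≤n+m; m+n∸n≡m; m∸n+n≡m; m+[n∸m]≡n; module ≤-Reasoning;
         +-*-semiring; *-commutativeSemigroup)
open import Data.Product using (∃; _×_; _,_)
open import Data.Sum using (_⊎_; inj₁; inj₂; [_,_]′; map₂)
open import Data.Sum.Properties using ([,]-map)
open import Data.Vec using (Vec; []; _∷_; _++_; lookup; tabulate; replicate; insertAt; removeAt)
open import Data.Vec.Properties
  using (lookup∘tabulate; tabulate∘lookup; tabulate-cong; lookup-splitAt; lookup-++ʳ;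
         insertAt-lookup; insertAt-punchIn; insertAt-removeAt)
open import Function using (_∘_; _⇔_; mk⇔; Equivalence; Injective)
open import Relation.Binary.PropositionalEquality
open import Relation.Nullary using (¬_; yes; no)
open import Relation.Nullary.Decidable using (⌊_⌋; toWitness; fromWitness)

open import Algebra.Properties.Semiring.Sum +-*-semiring
  using (sum-syntax; ∑-distrib-+; sum-cong-≗; sum-replicate-zero; *-distribʳ-sum)
open import Algebra.Properties.CommutativeSemigroup *-commutativeSemigroup using (x∙yz≈y∙xz)
open Equivalence using (to; from)

∑-mono-≤ : ∀ {n} {f g : Fin n → ℕ} → (∀ i → f i ≤ g i) → ∑[ i < n ] f i ≤ ∑[ i < n ] g i
∑-mono-≤ {zero}  f≤g = z≤n
∑-mono-≤ {suc n} f≤g = +-mono-≤ (f≤g zero) (∑-mono-≤ (f≤g ∘ suc))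

∑-const : ∀ n c → ∑[ i < n ] c ≡ n * c
∑-const zero    c = refl
∑-const (suc n) c = cong (c +_) (∑-const n c)

≗-lookup⇒≡ : ∀ {A : Set} {n} {xs ys : Vec A n} → (∀ i → lookup xs i ≡ lookup ys i) → xs ≡ ys
≗-lookup⇒≡ {xs = xs} {ys} eq = begin
  xs                   ≡⟨ tabulate∘lookup xs ⟨
  tabulate (lookup xs) ≡⟨ tabulate-cong eq ⟩
  tabulate (lookup ys) ≡⟨ tabulate∘lookup ys ⟩
  ys                   ∎
  where open ≡-Reasoning

removeAt-injective : ∀ {A : Set} {n} (xs ys : Vec A (suc n)) i →
  lookup xs i ≡ lookup ys i → removeAt xs i ≡ removeAt ys i → xs ≡ ys
removeAt-injective xs ys i xsᵢ≡ysᵢ eq = begin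
  xs                                      ≡⟨ insertAt-removeAt xs i ⟨
  insertAt (removeAt xs i) i (lookup xs i) ≡⟨ cong₂ (λ zs z → insertAt zs i z) eq xsᵢ≡ysᵢ ⟩
  insertAt (removeAt ys i) i (lookup ys i) ≡⟨ insertAt-removeAt ys i ⟩
  ys                                      ∎
  where open ≡-Reasoning

suc∣removeAt∣≡∣p∣ : ∀ {n} (p : Subset (suc n)) x → lookup p x ≡ true → suc ∣ removeAt p x ∣ ≡ ∣ p ∣
suc∣removeAt∣≡∣p∣ (true ∷ p) zero refl = refl
suc∣removeAt∣≡∣p∣ (true  ∷ p@(_ ∷ _)) (suc x) pₓ = cong suc (suc∣removeAt∣≡∣p∣ p x pₓ)
suc∣removeAt∣≡∣p∣ (false ∷ p@(_ ∷ _)) (suc x) pₓ = suc∣removeAt∣≡∣p∣ p x pₓ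

∑-lookup≡∣p∣ : ∀ {n} (p : Subset n) → ∑[ x < n ] (if lookup p x then 1 else 0) ≡ ∣ p ∣
∑-lookup≡∣p∣ []          = refl
∑-lookup≡∣p∣ (true  ∷ p) = cong suc (∑-lookup≡∣p∣ p)
∑-lookup≡∣p∣ (false ∷ p) = ∑-lookup≡∣p∣ p

lookup-image⇔ : ∀ {m n} (φ : Fin m → Fin n) (e : Subset m) j →
  lookup (image φ e) j ≡ true ⇔ ∃ λ i → lookup e i ≡ true × φ i ≡ j
lookup-image⇔ {m} φ e j = mk⇔ hit-from-image image-from-hit
  where
  hits : Fin m → Bool
  hits i = lookup e i ∧ ⌊ φ i ≟ j ⌋

  lookup-image : lookup (image φ e) j ≡ any hits (allFin m)
  lookup-image = lookup∘tabulate _ j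

  hit-from-image : lookup (image φ e) j ≡ true → ∃ λ i → lookup e i ≡ true × φ i ≡ j
  hit-from-image h
    with i , hitᵢ ← satisfied (any⁻ hits (allFin m) (from T-≡ (trans (sym lookup-image) h)))
    with eᵢ , φᵢ≡j ← to T-∧ hitᵢ
    = i , to T-≡ eᵢ , toWitness φᵢ≡j

  image-from-hit : (∃ λ i → lookup e i ≡ true × φ i ≡ j) → lookup (image φ e) j ≡ true
  image-from-hit (i , eᵢ , refl) = trans lookup-image
    (to T-≡ (any⁺ hits (lose (∈-allFin i) (from T-∧ (from T-≡ eᵢ , fromWitness refl)))))

image-∘ : ∀ {l m n} (f : Fin m → Fin n) (g : Fin l → Fin m) e → image (f ∘ g) e ≡ image f (image g e)
image-∘ f g e = ≗-lookup⇒≡ λ j → ⇔→≡ (mk⇔ (forward j) (backward j))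
  where
  forward : ∀ j → lookup (image (f ∘ g) e) j ≡ true → lookup (image f (image g e)) j ≡ true
  forward j h with i , eᵢ , refl ← to (lookup-image⇔ (f ∘ g) e j) h =
    from (lookup-image⇔ f (image g e) j) (g i , from (lookup-image⇔ g e (g i)) (i , eᵢ , refl) , refl)

  backward : ∀ j → lookup (image f (image g e)) j ≡ true → lookup (image (f ∘ g) e) j ≡ true
  backward j h
    with i′ , gₑᵢ′ , refl ← to (lookup-image⇔ f (image g e) j) h
    with i , eᵢ , refl ← to (lookup-image⇔ g e i′) gₑᵢ′
    = from (lookup-image⇔ (f ∘ g) e j) (i , eᵢ , refl)

lookup-image-inverse : ∀ {m n} (σ : Fin m → Fin n) (τ : Fin n → Fin m) →
  (∀ i → τ (σ i) ≡ i) → (∀ j → σ (τ j) ≡ j) → ∀ e j → lookup (image σ e) j ≡ lookup e (τ j)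
lookup-image-inverse σ τ τσ στ e j = ⇔→≡ (mk⇔ forward backward)
  where
  forward : lookup (image σ e) j ≡ true → lookup e (τ j) ≡ true
  forward h with i , eᵢ , refl ← to (lookup-image⇔ σ e j) h = subst (λ i → lookup e i ≡ true) (sym (τσ i)) eᵢ

  backward : lookup e (τ j) ≡ true → lookup (image σ e) j ≡ true
  backward eτⱼ = from (lookup-image⇔ σ e j) (τ j , eτⱼ , στ j)

Contains-trans : ∀ {l m n} {G₁ : List (Subset l)} {G₂ : List (Subset m)} {G₃ : List (Subset n)} →
  Contains G₁ G₂ → Contains G₂ G₃ → Contains G₁ G₃
Contains-trans (φ , φ-inj , φ-maps) (ψ , ψ-inj , ψ-maps) =
  ψ ∘ φ , φ-inj ∘ ψ-inj , All.map (λ {e} φe∈ → subst (_∈ _) (sym (image-∘ ψ φ e)) (All.lookup ψ-maps φe∈)) φ-maps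

linkEdges : ∀ {n} → Fin (suc n) → List (Subset (suc n)) → List (Subset n)
linkEdges x []       = []
linkEdges x (E ∷ Es) = if lookup E x then removeAt E x ∷ linkEdges x Es else linkEdges x Es

linkEdges-All : ∀ {n} (x : Fin (suc n)) {P : Subset (suc n) → Set} {Q : Subset n → Set} →
  (∀ E → lookup E x ≡ true → P E → Q (removeAt E x)) → ∀ {Es} → All P Es → All Q (linkEdges x Es)
linkEdges-All x P⇒Q [] = []
linkEdges-All x P⇒Q {E ∷ Es} (pE ∷ pEs) with lookup E x in Eₓ
... | true  = P⇒Q E Eₓ pE ∷ linkEdges-All x P⇒Q pEs
... | false = linkEdges-All x P⇒Q pEs

∈-linkEdges⁻ : ∀ {n} (x : Fin (suc n)) {Es e} → e ∈ linkEdges x Es →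
  ∃ λ E → E ∈ Es × lookup E x ≡ true × removeAt E x ≡ e
∈-linkEdges⁻ x {Es} =
  All.lookup (linkEdges-All x {Q = Witnessed} (λ E Eₓ E∈ → E , E∈ , Eₓ , refl) (All.tabulate (λ E∈ → E∈)))
  where
  Witnessed : Subset _ → Set
  Witnessed e = ∃ λ E → E ∈ Es × lookup E x ≡ true × removeAt E x ≡ e

linkEdges-unique : ∀ {n} (x : Fin (suc n)) {Es} → Unique Es → Unique (linkEdges x Es)
linkEdges-unique x [] = []
linkEdges-unique x {E ∷ Es} (E∉Es ∷ uEs) with lookup E x in Eₓ
... | true  = linkEdges-All x (λ E′ E′ₓ E≢E′ eq → E≢E′ (removeAt-injective E E′ x (trans Eₓ (sym E′ₓ)) eq)) E∉Es
            ∷ linkEdges-unique x uEs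
... | false = linkEdges-unique x uEs

link : ∀ {r n} → Hypergraph (suc r) (suc n) → Fin (suc n) → Hypergraph r n
link H x = record
  { edges   = linkEdges x (edges H)
  ; unique  = linkEdges-unique x (unique H)
  ; uniform = linkEdges-All x (λ E Eₓ ∣E∣≡ → suc-injective (trans (suc∣removeAt∣≡∣p∣ E x Eₓ) ∣E∣≡)) (uniform H)
  }

∑-e[link]≡e[H]*r : ∀ {r n} (H : Hypergraph (suc r) (suc n)) → ∑[ x < suc n ] e[ link H x ] ≡ e[ H ] * suc r
∑-e[link]≡e[H]*r {r} {n} H = handshake (uniform H)
  where
  length-linkEdges-∷ : ∀ E Es x →
    length (linkEdges x (E ∷ Es)) ≡ (if lookup E x then 1 else 0) + length (linkEdges x Es)
  length-linkEdges-∷ E Es x with lookup E x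
  ... | true  = refl
  ... | false = refl

  handshake : ∀ {Es} → All (λ E → ∣ E ∣ ≡ suc r) Es →
    ∑[ x < suc n ] length (linkEdges x Es) ≡ length Es * suc r
  handshake [] = sum-replicate-zero (suc n)
  handshake {E ∷ Es} (∣E∣≡ ∷ ∣Es∣≡) = begin
    ∑[ x < suc n ] length (linkEdges x (E ∷ Es))
      ≡⟨ sum-cong-≗ (length-linkEdges-∷ E Es) ⟩
    ∑[ x < suc n ] ((if lookup E x then 1 else 0) + length (linkEdges x Es))
      ≡⟨ ∑-distrib-+ (λ x → if lookup E x then 1 else 0) (λ x → length (linkEdges x Es)) ⟩
    ∑[ x < suc n ] (if lookup E x then 1 else 0) + ∑[ x < suc n ] length (linkEdges x Es)
      ≡⟨ cong₂ _+_ (trans (∑-lookup≡∣p∣ E) ∣E∣≡) (handshake ∣Es∣≡) ⟩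
    suc r + length Es * suc r
      ∎
    where open ≡-Reasoning

cone : ∀ {m} → List (Subset m) → List (Subset (suc m))
cone = map (true ∷_)

extendAt : ∀ {m n} → Fin (suc n) → (Fin m → Fin n) → Fin (suc m) → Fin (suc n)
extendAt x φ zero    = x
extendAt x φ (suc i) = punchIn x (φ i)

extendAt-injective : ∀ {m n} (x : Fin (suc n)) {φ : Fin m → Fin n} →
  Injective _≡_ _≡_ φ → Injective _≡_ _≡_ (extendAt x φ)
extendAt-injective x φ-inj {zero}  {zero}  eq = refl
extendAt-injective x φ-inj {zero}  {suc j} eq = ⊥-elim (punchInᵢ≢i x _ (sym eq))
extendAt-injective x φ-inj {suc i} {zero}  eq = ⊥-elim (punchInᵢ≢i x _ eq)
extendAt-injective x φ-inj {suc i} {suc j} eq = cong suc (φ-inj (punchIn-injective x _ _ eq))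

image-extendAt : ∀ {m n} (x : Fin (suc n)) (φ : Fin m → Fin n) b e →
  image (extendAt x φ) (b ∷ e) ≡ insertAt (image φ e) x b
image-extendAt x φ b e = ≗-lookup⇒≡ pointwise
  where
  ψ = extendAt x φ

  at-x : lookup (image ψ (b ∷ e)) x ≡ b
  at-x = ⇔→≡ (mk⇔ forward backward)
    where
    forward : lookup (image ψ (b ∷ e)) x ≡ true → b ≡ true
    forward h with to (lookup-image⇔ ψ (b ∷ e) x) h
    ... | zero  , b≡true , _    = b≡true
    ... | suc i , _      , ψᵢ≡x = ⊥-elim (punchInᵢ≢i x (φ i) ψᵢ≡x)

    backward : b ≡ true → lookup (image ψ (b ∷ e)) x ≡ true
    backward b≡true = from (lookup-image⇔ ψ (b ∷ e) x) (zero , b≡true , refl)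

  at-punchIn : ∀ j → lookup (image ψ (b ∷ e)) (punchIn x j) ≡ lookup (image φ e) j
  at-punchIn j = ⇔→≡ (mk⇔ forward backward)
    where
    forward : lookup (image ψ (b ∷ e)) (punchIn x j) ≡ true → lookup (image φ e) j ≡ true
    forward h with to (lookup-image⇔ ψ (b ∷ e) (punchIn x j)) h
    ... | zero  , _  , x≡ψⱼ = ⊥-elim (punchInᵢ≢i x j (sym x≡ψⱼ))
    ... | suc i , eᵢ , ψᵢ≡ψⱼ = from (lookup-image⇔ φ e j) (i , eᵢ , punchIn-injective x _ _ ψᵢ≡ψⱼ)

    backward : lookup (image φ e) j ≡ true → lookup (image ψ (b ∷ e)) (punchIn x j) ≡ true
    backward h with i , eᵢ , refl ← to (lookup-image⇔ φ e j) h =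
      from (lookup-image⇔ ψ (b ∷ e) (punchIn x j)) (suc i , eᵢ , refl)

  pointwise : ∀ j → lookup (image ψ (b ∷ e)) j ≡ lookup (insertAt (image φ e) x b) j
  pointwise j with x ≟ j
  ... | yes refl = trans at-x (sym (insertAt-lookup (image φ e) x b))
  ... | no x≢j   = begin
    lookup (image ψ (b ∷ e)) j                          ≡⟨ cong (lookup (image ψ (b ∷ e))) (punchIn-punchOut x≢j) ⟨
    lookup (image ψ (b ∷ e)) (punchIn x (punchOut x≢j)) ≡⟨ at-punchIn (punchOut x≢j) ⟩
    lookup (image φ e) (punchOut x≢j)                   ≡⟨ insertAt-punchIn (image φ e) x b (punchOut x≢j) ⟨
    lookup (insertAt (image φ e) x b) (punchIn x (punchOut x≢j)) ≡⟨ cong (lookup (insertAt (image φ e) x b)) (punchIn-punchOut x≢j) ⟩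
    lookup (insertAt (image φ e) x b) j                 ∎
    where open ≡-Reasoning

Contains-link⇒Contains-cone : ∀ {m n} {G : List (Subset m)} (x : Fin (suc n)) (Es : List (Subset (suc n))) →
  Contains G (linkEdges x Es) → Contains (cone G) Es
Contains-link⇒Contains-cone x Es (φ , φ-inj , φ-maps) =
  extendAt x φ , extendAt-injective x φ-inj , All.map⁺ (All.map apex-edge φ-maps)
  where
  apex-edge : ∀ {e} → image φ e ∈ linkEdges x Es → image (extendAt x φ) (true ∷ e) ∈ Es
  apex-edge {e} φe∈ with E , E∈ , Eₓ , E-x≡φe ← ∈-linkEdges⁻ x φe∈ = subst (_∈ Es) (sym image≡E) E∈
    where
    open ≡-Reasoning
    image≡E : image (extendAt x φ) (true ∷ e) ≡ E
    image≡E = begin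
      image (extendAt x φ) (true ∷ e)          ≡⟨ image-extendAt x φ true e ⟩
      insertAt (image φ e) x true              ≡⟨ cong₂ (λ u b → insertAt u x b) (sym E-x≡φe) (sym Eₓ) ⟩
      insertAt (removeAt E x) x (lookup E x)   ≡⟨ insertAt-removeAt E x ⟩
      E                                        ∎

moveToFront : ∀ m {t} → Fin m ⊎ Fin (suc t) → Fin (suc (m + t))
moveToFront m (inj₁ i)       = suc (i ↑ˡ _)
moveToFront m (inj₂ zero)    = zero
moveToFront m (inj₂ (suc i)) = suc (m ↑ʳ i)

toFront : ∀ m {t} → Fin (m + suc t) → Fin (suc (m + t))
toFront m = moveToFront m ∘ splitAt m

fromFront : ∀ m {t} → Fin (suc (m + t)) → Fin (m + suc t)
fromFront m zero    = m ↑ʳ zero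
fromFront m (suc i) = join m _ (map₂ suc (splitAt m i))

toFront-fromFront : ∀ m {t} (j : Fin (suc (m + t))) → toFront m (fromFront m j) ≡ j
toFront-fromFront m {t} zero    = cong (moveToFront m) (splitAt-↑ʳ m (suc t) zero)
toFront-fromFront m {t} (suc i) = begin
  moveToFront m (splitAt m (join m (suc t) (map₂ suc (splitAt m i))))
    ≡⟨ cong (moveToFront m) (splitAt-join m (suc t) (map₂ suc (splitAt m i))) ⟩
  moveToFront m (map₂ suc (splitAt m i))
    ≡⟨ moveToFront-map₂ (splitAt m i) ⟩
  suc (join m t (splitAt m i))
    ≡⟨ cong suc (join-splitAt m t i) ⟩
  suc i
    ∎
  where
  open ≡-Reasoning
  moveToFront-map₂ : ∀ w → moveToFront m (map₂ suc w) ≡ suc (join m t w)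
  moveToFront-map₂ (inj₁ _) = refl
  moveToFront-map₂ (inj₂ _) = refl

fromFront-toFront : ∀ m {t} (i : Fin (m + suc t)) → fromFront m (toFront m i) ≡ i
fromFront-toFront m {t} i = trans (fromFront-moveToFront (splitAt m i)) (join-splitAt m (suc t) i)
  where
  fromFront-moveToFront : ∀ w → fromFront m (moveToFront m w) ≡ join m (suc t) w
  fromFront-moveToFront (inj₁ a)       = cong (join m (suc t) ∘ map₂ suc) (splitAt-↑ˡ m a t)
  fromFront-moveToFront (inj₂ zero)    = refl
  fromFront-moveToFront (inj₂ (suc b)) = cong (join m (suc t) ∘ map₂ suc) (splitAt-↑ʳ m t b)

image-toFront : ∀ {m t} (xs : Subset m) b (ys : Subset t) → image (toFront m) (xs ++ b ∷ ys) ≡ b ∷ (xs ++ ys)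
image-toFront {m} {t} xs b ys = ≗-lookup⇒≡ λ j → trans
  (lookup-image-inverse (toFront m) (fromFront m) (fromFront-toFront m) (toFront-fromFront m) (xs ++ b ∷ ys) j)
  (lookup-fromFront j)
  where
  open ≡-Reasoning
  lookup-fromFront : ∀ j → lookup (xs ++ b ∷ ys) (fromFront m j) ≡ lookup (b ∷ (xs ++ ys)) j
  lookup-fromFront zero    = lookup-++ʳ xs (b ∷ ys) zero
  lookup-fromFront (suc i) = begin
    lookup (xs ++ b ∷ ys) (join m (suc t) (map₂ suc (splitAt m i)))
      ≡⟨ lookup-splitAt m xs (b ∷ ys) _ ⟩
    [ lookup xs , lookup (b ∷ ys) ]′ (splitAt m (join m (suc t) (map₂ suc (splitAt m i))))
      ≡⟨ cong [ lookup xs , lookup (b ∷ ys) ]′ (splitAt-join m (suc t) (map₂ suc (splitAt m i))) ⟩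
    [ lookup xs , lookup (b ∷ ys) ]′ (map₂ suc (splitAt m i))
      ≡⟨ [,]-map (splitAt m i) ⟩
    [ lookup xs , lookup ys ]′ (splitAt m i)
      ≡⟨ lookup-splitAt m xs ys i ⟨
    lookup (xs ++ ys) i
      ∎

Susp-suc⊑cone : ∀ {v} t (F : Hypergraph 2 v) → Contains (Susp (3 + t) F) (cone (Susp (2 + t) F))
Susp-suc⊑cone {v} t F = toFront v , toFront-injective , All.map⁺ (All.tabulate apex-first)
  where
  toFront-injective : Injective _≡_ _≡_ (toFront v {t})
  toFront-injective {i} {i′} eq =
    trans (sym (fromFront-toFront v i)) (trans (cong (fromFront v) eq) (fromFront-toFront v i′))

  apex-first : ∀ {e} → e ∈ edges F → image (toFront v) (e ++ replicate (suc t) true) ∈ cone (Susp (2 + t) F)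
  apex-first {e} e∈ = subst (_∈ cone (Susp (2 + t) F)) (sym (image-toFront e true (replicate t true)))
    (∈-map⁺ (true ∷_) (∈-map⁺ (_++ replicate t true) e∈))

link-Susp-free : ∀ {v r n} (F : Hypergraph 2 v) → 2 ≤ r → (H : Hypergraph (suc r) (suc n)) →
  ¬ Contains (Susp (suc r) F) (edges H) → ∀ x → ¬ Contains (Susp r F) (edges (link H x))
link-Susp-free {r = suc (suc t)} F (s≤s (s≤s z≤n)) H H-free x =
  H-free ∘ Contains-trans (Susp-suc⊑cone t F) ∘ Contains-link⇒Contains-cone x (edges H)

[k+1]*[n+1]C[k+1]≡[n+1]*nCk : ∀ n k → suc k * (suc n C suc k) ≡ suc n * (n C k)
[k+1]*[n+1]C[k+1]≡[n+1]*nCk zero    zero    = refl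
[k+1]*[n+1]C[k+1]≡[n+1]*nCk zero    (suc k) = *-zeroʳ (2 + k)
[k+1]*[n+1]C[k+1]≡[n+1]*nCk (suc n) zero    =
  trans (+-identityʳ _) (trans (nC1≡n (2 + n)) (sym (*-identityʳ (2 + n))))
[k+1]*[n+1]C[k+1]≡[n+1]*nCk (suc n) (suc k) = begin
  (2 + k) * ((2 + n) C (2 + k))              ≡⟨ cong ((2 + k) *_) (nCk+nC[k+1]≡[n+1]C[k+1] (suc n) (suc k)) ⟨
  (2 + k) * (A + B)                          ≡⟨ regroup (suc k) A B ⟩
  (suc k * A + A) + (2 + k) * B              ≡⟨ cong₂ (λ x y → (x + A) + y)
                                                  ([k+1]*[n+1]C[k+1]≡[n+1]*nCk n k)
                                                  ([k+1]*[n+1]C[k+1]≡[n+1]*nCk n (suc k)) ⟩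
  (suc n * (n C k) + A) + suc n * (n C suc k) ≡⟨ regroup′ (suc n) (n C k) (n C suc k) A ⟩
  suc n * (n C k + n C suc k) + A            ≡⟨ cong (λ x → suc n * x + A) (nCk+nC[k+1]≡[n+1]C[k+1] n k) ⟩
  suc n * A + A                              ≡⟨ +-comm (suc n * A) A ⟩
  (2 + n) * A                                ∎
  where
  open ≡-Reasoning
  A = suc n C suc k
  B = suc n C (2 + k)
  regroup : ∀ c a b → suc c * (a + b) ≡ (c * a + a) + suc c * b
  regroup = solve-∀
  regroup′ : ∀ p x y a → (p * x + a) + p * y ≡ p * (x + y) + a
  regroup′ = solve-∀

[j+k]Ck≡[j+k]Cj : ∀ j k → (j + k) C k ≡ (j + k) C j
[j+k]Ck≡[j+k]Cj j k = trans (nCk≡nC[n∸k] (m≤n+m k j)) (cong ((j + k) C_) (m+n∸n≡m j k))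

[j+1]*[j+k+1]Ck≡[j+k+1]*[j+k]Ck : ∀ j k → suc j * (suc (j + k) C k) ≡ suc (j + k) * ((j + k) C k)
[j+1]*[j+k+1]Ck≡[j+k+1]*[j+k]Ck j k = begin
  suc j * (suc (j + k) C k)       ≡⟨ cong (suc j *_) ([j+k]Ck≡[j+k]Cj (suc j) k) ⟩
  suc j * (suc (j + k) C suc j)   ≡⟨ [k+1]*[n+1]C[k+1]≡[n+1]*nCk (j + k) j ⟩
  suc (j + k) * ((j + k) C j)     ≡⟨ cong (suc (j + k) *_) ([j+k]Ck≡[j+k]Cj j k) ⟨
  suc (j + k) * ((j + k) C k)     ∎
  where open ≡-Reasoning

module _ {v} (F : Hypergraph 2 v) {k m b : ℕ} (2≤k : 2 ≤ k)
         (ex-bound : ∀ (G : Hypergraph k m) → ¬ Contains (Susp k F) (edges G) → e[ G ] ≤ b) where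

  Susp-free-bound : ∀ j {r n} → j + k ≡ r → j + m ≡ n → (H : Hypergraph r n) →
    ¬ Contains (Susp r F) (edges H) → e[ H ] * (r C k) ≤ (n C j) * b
  Susp-free-bound zero refl refl H H-free = begin
    e[ H ] * (k C k) ≡⟨ cong (e[ H ] *_) (nCn≡1 k) ⟩
    e[ H ] * 1       ≡⟨ *-identityʳ e[ H ] ⟩
    e[ H ]           ≤⟨ ex-bound H H-free ⟩
    b                ≡⟨ *-identityˡ b ⟨
    1 * b            ∎
    where open ≤-Reasoning
  Susp-free-bound (suc j) refl refl H H-free = *-cancelˡ-≤ (suc j) (begin
    suc j * (e[ H ] * (suc R C k))                ≡⟨ x∙yz≈y∙xz (suc j) e[ H ] (suc R C k) ⟩
    e[ H ] * (suc j * (suc R C k))                ≡⟨ cong (e[ H ] *_) ([j+1]*[j+k+1]Ck≡[j+k+1]*[j+k]Ck j k) ⟩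
    e[ H ] * (suc R * (R C k))                    ≡⟨ *-assoc e[ H ] (suc R) (R C k) ⟨
    e[ H ] * suc R * (R C k)                      ≡⟨ cong (_* (R C k)) (∑-e[link]≡e[H]*r H) ⟨
    (∑[ x < suc N ] e[ link H x ]) * (R C k)      ≡⟨ *-distribʳ-sum (R C k) (λ x → e[ link H x ]) ⟩
    ∑[ x < suc N ] (e[ link H x ] * (R C k))      ≤⟨ ∑-mono-≤ link-bound ⟩
    ∑[ x < suc N ] ((N C j) * b)                  ≡⟨ ∑-const (suc N) ((N C j) * b) ⟩
    suc N * ((N C j) * b)                         ≡⟨ *-assoc (suc N) (N C j) b ⟨
    suc N * (N C j) * b                           ≡⟨ cong (_* b) ([k+1]*[n+1]C[k+1]≡[n+1]*nCk N j) ⟨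
    suc j * (suc N C suc j) * b                   ≡⟨ *-assoc (suc j) (suc N C suc j) b ⟩
    suc j * ((suc N C suc j) * b)                 ∎)
    where
    open ≤-Reasoning
    R = j + k
    N = j + m
    link-bound : ∀ x → e[ link H x ] * (R C k) ≤ (N C j) * b
    link-bound x = Susp-free-bound j refl refl (link H x)
      (link-Susp-free F (≤-trans 2≤k (m≤n+m k j)) H H-free x)

proposition1p1 : (k r : ℕ) → 2 ≤ k → k < r →
    (v : ℕ) (F : Hypergraph 2 v) (n : ℕ) → r ≤ n →
    (a b : ℕ) → IsEx r n (Susp r F) a → IsEx k (n ∸ r + k) (Susp k F) b →
    a * (r C k) ≤ (n C (r ∸ k)) * b
proposition1p1 k r 2≤k k<r v F n r≤n a b ((H , H-free , refl) , _) (_ , ex-bound) =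
  Susp-free-bound F 2≤k ex-bound (r ∸ k) (m∸n+n≡m k≤r) vertex-count H H-free
  where
  k≤r : k ≤ r
  k≤r = <⇒≤ k<r
  vertex-count : r ∸ k + (n ∸ r + k) ≡ n
  vertex-count = begin
    r ∸ k + (n ∸ r + k)   ≡⟨ cong (r ∸ k +_) (+-comm (n ∸ r) k) ⟩
    r ∸ k + (k + (n ∸ r)) ≡⟨ +-assoc (r ∸ k) k (n ∸ r) ⟨
    r ∸ k + k + (n ∸ r)   ≡⟨ cong (_+ (n ∸ r)) (m∸n+n≡m k≤r) ⟩
    r + (n ∸ r)           ≡⟨ m+[n∸m]≡n r≤n ⟩
    n                     ∎
    where open ≡-Reasoning
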